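{- Let $0 < \alpha < 1$ be irrational. Then $$\lim_{n \to \infty} \frac{|\mathcal{F}_n(\alpha)|}{n} = 0.$$
   Context: For an integer $n\ge1$, the Farey series $\mathcal{F}_n$ is the set of rationals $a/b\in[0,1]$ with $\gcd(a,b)=1$ and $1 \le b\le n$. The sequence of Farey approximations of $\alpha$ is defined by $F_0(\alpha) = 0/1$, $F_1(\alpha) = 1/1$, and for $k \geq 2$, $F_k(\alpha) = \frac{a+c}{b+d}$, where $\frac{a}{b} = \min_{0 \leq j < k}\{F_j(\alpha) : F_j(\alpha) > \alpha\}$ and $\frac{c}{d} = \max_{0 \leq j < k}\{F_j(\alpha) : F_j(\alpha) < \alpha\}$, both written in lowest terms ($\gcd(a,b)=\gcd(c,d)=1$). Then $\mathcal{F}_n(\alpha) := \mathcal{F}_n \cap \{F_k(\alpha)\}_{k=0}^{n}$. -}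

module Defs where

open import Data.Bool using (Bool; true; false; if_then_else_)
open import Data.Nat as ℕ using (ℕ; zero; suc)
import Data.Integer as ℤ
open import Data.Rational
  using (ℚ; 0ℚ; 1ℚ; _/_; _≤_; _<_; _⊓_; _⊔_; ↥_; ↧ₙ_)
open import Data.Rational.Properties using (_≟_; _≤?_)
open import Data.List using (List; []; _∷_; filter; length; deduplicate)
open import Data.Product using (∃; _×_)
open import Relation.Nullary.Decidable using (_×-dec_)
open import Relation.Binary.PropositionalEquality using (_≡_)

-- An irrational number α with 0 < α < 1, given by its (Dedekind) cut on ℚ:
-- below q ≡ true  iff  q < α.  Openness of both halves means the cut has no
-- rational boundary point, i.e. α is irrational.
record IrrationalIn01 : Set where
  field
    below       : ℚ → Bool
    below-0     : below 0ℚ ≡ true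
    notBelow-1  : below 1ℚ ≡ false
    downClosed  : ∀ p q → p ≤ q → below q ≡ true → below p ≡ true
    lowerOpen   : ∀ q → below q ≡ true → ∃ λ r → q < r × below r ≡ true
    upperOpen   : ∀ q → below q ≡ false → ∃ λ r → r < q × below r ≡ false
open IrrationalIn01 public

mediant : ℚ → ℚ → ℚ
mediant p q = (↥ p ℤ.+ ↥ q) / (↧ₙ p ℕ.+ ↧ₙ q)

-- min of the elements of L lying above α (default 1, which is always in L)
minAbove : IrrationalIn01 → List ℚ → ℚ
minAbove α [] = 1ℚ
minAbove α (q ∷ L) = if below α q then minAbove α L else (q ⊓ minAbove α L)

-- max of the elements of L lying below α (default 0, which is always in L)
maxBelow : IrrationalIn01 → List ℚ → ℚ
maxBelow α [] = 0ℚ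
maxBelow α (q ∷ L) = if below α q then (q ⊔ maxBelow α L) else maxBelow α L

step : IrrationalIn01 → List ℚ → List ℚ
step α L = mediant (minAbove α L) (maxBelow α L) ∷ L

-- approxs α k = [F_{k-1}(α), …, F_1(α), F_0(α)]
approxs : IrrationalIn01 → ℕ → List ℚ
approxs α zero = []
approxs α (suc zero) = 0ℚ ∷ []
approxs α (suc (suc zero)) = 1ℚ ∷ 0ℚ ∷ []
approxs α (suc (suc (suc k))) = step α (approxs α (suc (suc k)))

-- |𝓕_n(α)| = number of distinct elements of {F_0(α),…,F_n(α)} lying in 𝓕_n
-- (i.e. in [0,1] with denominator ≤ n)
fareyCount : IrrationalIn01 → ℕ → ℕ
fareyCount α n =
  length (deduplicate _≟_
    (filter (λ q → (0ℚ ≤? q) ×-dec ((q ≤? 1ℚ) ×-dec (↧ₙ q ℕ.≤? n)))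
            (approxs α (suc n))))

module Submission where

open import Defs
open import Data.Bool using (true; false; if_then_else_)
open import Data.Empty using (⊥-elim)
open import Data.Integer as ℤ using (+_; 1ℤ)
open import Data.Integer.GCD using (gcd)
import Data.Integer.Properties as ℤP
open import Data.Integer.Tactic.RingSolver using (solve-∀)
open import Data.List using (List; []; _∷_; _++_; filter; length; map; applyDownFrom)
import Data.List.Properties as ListP
open import Data.Nat as ℕ using (ℕ; zero; suc; NonZero; _≤_; z≤n; s≤s)
import Data.Nat.Properties as ℕP
open import Data.Nat.Tactic.RingSolver renaming (solve-∀ to ℕ-solve-∀)
open import Data.Product using (∃; _×_; _,_; proj₁; proj₂)
open import Data.Rational as ℚ using (ℚ; 0ℚ; 1ℚ; _<_; _/_; _⊓_; _⊔_; ↥_; ↧_; ↧ₙ_)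
import Data.Rational.Properties as ℚP
open import Data.Rational.Unnormalised as ℚᵘ using (mkℚᵘ)
import Data.Rational.Unnormalised.Properties as ℚᵘP
open import Data.Sum using (_⊎_; inj₁; inj₂)
open import Function using (_∘_)
open import Relation.Binary.PropositionalEquality
open import Relation.Nullary using (yes; no)
open import Relation.Nullary.Decidable using (_×-dec_)
open import Relation.Unary using (Pred; Decidable)

-- From F_2 on, every approximation is the mediant of the current bracket lo < α < hi, whose
-- endpoints are Farey neighbours (↥hi·↧lo − ↥lo·↧hi = 1); the mediant of neighbours is already
-- reduced and is a neighbour of both, so ↧F = ↧lo + ↧hi and the mediant replaces one endpoint.
-- A rational strictly between neighbours has denominator at least ↧lo + ↧hi; since α is
-- irrational there is a rational strictly between α and each endpoint, so no endpoint can stay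
-- fixed forever and both endpoint denominators tend to infinity. Once both exceed M, the
-- denominators of the F_k grow by at least M per step, so at most about n/M of F_0, …, F_n have
-- denominator ≤ n.

stepwise-mono : (f : ℕ → ℕ) → (∀ k → f k ≤ f (suc k)) → ∀ {k j} → k ≤ j → f k ≤ f j
stepwise-mono f step k≤j = go (ℕP.≤⇒≤′ k≤j)
  where
  go : ∀ {k j} → k ℕ.≤′ j → f k ≤ f j
  go ℕ.≤′-refl         = ℕP.≤-refl
  go (ℕ.≤′-step k≤′j) = ℕP.≤-trans (go k≤′j) (step _)

length-filter-map : ∀ {a b p q} {A : Set a} {B : Set b} {P : Pred A p} {Q : Pred B q}
                    (P? : Decidable P) (Q? : Decidable Q) (f : A → B) → (∀ {x} → P x → Q (f x)) →
                    ∀ xs → length (filter P? xs) ≤ length (filter Q? (map f xs))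
length-filter-map P? Q? f P⇒Q [] = z≤n
length-filter-map P? Q? f P⇒Q (x ∷ xs) with P? x | Q? (f x)
... | yes _  | yes _   = s≤s (length-filter-map P? Q? f P⇒Q xs)
... | yes px | no ¬qfx = ⊥-elim (¬qfx (P⇒Q px))
... | no _   | yes _   = ℕP.m≤n⇒m≤1+n (length-filter-map P? Q? f P⇒Q xs)
... | no _   | no _    = length-filter-map P? Q? f P⇒Q xs

eventual-growth⇒linear : ∀ {D : ℕ → ℕ} {M K} → (∀ i → K ≤ i → M ℕ.+ D i ≤ D (suc i)) →
                ∀ i → i ℕ.* M ≤ K ℕ.* M ℕ.+ D i
eventual-growth⇒linear grow zero = z≤n
eventual-growth⇒linear {D} {M} {K} grow (suc i) with K ℕ.≤? i
... | yes K≤i = begin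
  M ℕ.+ i ℕ.* M                 ≤⟨ ℕP.+-monoʳ-≤ M (eventual-growth⇒linear grow i) ⟩
  M ℕ.+ (K ℕ.* M ℕ.+ D i)       ≡⟨ ℕP.+-comm M (K ℕ.* M ℕ.+ D i) ⟩
  K ℕ.* M ℕ.+ D i ℕ.+ M         ≡⟨ ℕP.+-assoc (K ℕ.* M) (D i) M ⟩
  K ℕ.* M ℕ.+ (D i ℕ.+ M)       ≡⟨ cong (K ℕ.* M ℕ.+_) (ℕP.+-comm (D i) M) ⟩
  K ℕ.* M ℕ.+ (M ℕ.+ D i)       ≤⟨ ℕP.+-monoʳ-≤ (K ℕ.* M) (grow i K≤i) ⟩
  K ℕ.* M ℕ.+ D (suc i)         ∎
  where open ℕP.≤-Reasoning
... | no K≰i = ℕP.≤-trans (ℕP.*-monoˡ-≤ M (ℕP.≰⇒> K≰i)) (ℕP.m≤m+n (K ℕ.* M) (D (suc i)))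

count≤ : ℕ → List ℕ → ℕ
count≤ n ds = length (filter (ℕ._≤? n) ds)

count≤-applyDownFrom-linear : ∀ {D : ℕ → ℕ} {M K} → (∀ i → i ℕ.* M ≤ K ℕ.* M ℕ.+ D i) →
                 ∀ n j → count≤ n (applyDownFrom D j) ℕ.* M ≤ K ℕ.* M ℕ.+ n ℕ.+ M
count≤-applyDownFrom-linear lb n zero = z≤n
count≤-applyDownFrom-linear {D} {M} {K} lb n (suc j) with D j ℕ.≤? n
... | no D≰n = begin
  count≤ n (D j ∷ applyDownFrom D j) ℕ.* M   ≡⟨ cong (λ ds → length ds ℕ.* M) (ListP.filter-reject (ℕ._≤? n) D≰n) ⟩
  count≤ n (applyDownFrom D j) ℕ.* M         ≤⟨ count≤-applyDownFrom-linear {K = K} lb n j ⟩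
  K ℕ.* M ℕ.+ n ℕ.+ M                     ∎
  where open ℕP.≤-Reasoning
... | yes D≤n = begin
  count≤ n (D j ∷ applyDownFrom D j) ℕ.* M   ≡⟨ cong (λ ds → length ds ℕ.* M) (ListP.filter-accept (ℕ._≤? n) D≤n) ⟩
  M ℕ.+ count≤ n (applyDownFrom D j) ℕ.* M   ≤⟨ ℕP.+-monoʳ-≤ M (ℕP.*-monoˡ-≤ M count≤j) ⟩
  M ℕ.+ j ℕ.* M                           ≡⟨ ℕP.+-comm M (j ℕ.* M) ⟩
  j ℕ.* M ℕ.+ M                           ≤⟨ ℕP.+-monoˡ-≤ M (ℕP.≤-trans (lb j) (ℕP.+-monoʳ-≤ (K ℕ.* M) D≤n)) ⟩
  K ℕ.* M ℕ.+ n ℕ.+ M                     ∎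
  where
  open ℕP.≤-Reasoning
  count≤j : count≤ n (applyDownFrom D j) ≤ j
  count≤j = ℕP.≤-trans (ListP.length-filter (ℕ._≤? n) (applyDownFrom D j))
                       (ℕP.≤-reflexive (ListP.length-applyDownFrom D j))

record Neighbours (l u : ℚ) : Set where
  constructor neighbours
  field det≡1 : ↥ u ℤ.* ↧ l ℤ.- ↥ l ℤ.* ↧ u ≡ 1ℤ

bézout⇒/-reduced : ∀ i n .{{_ : NonZero n}} x y → i ℤ.* y ℤ.- x ℤ.* + n ≡ 1ℤ →
                   ↥ (i / n) ≡ i × ↧ₙ (i / n) ≡ n
bézout⇒/-reduced i n x y bézout = ↥≡ , ℤP.+-injective ↧≡
  where
  g = gcd i (+ n)
  ↥*g : ↥ (i / n) ℤ.* g ≡ i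
  ↥*g = ℚP.↥-/ i n
  ↧*g : ↧ (i / n) ℤ.* g ≡ + n
  ↧*g = ℚP.↧-/ i n
  g*[…]≡1 : g ℤ.* (↥ (i / n) ℤ.* y ℤ.- x ℤ.* ↧ (i / n)) ≡ 1ℤ
  g*[…]≡1 = begin
    g ℤ.* (↥ (i / n) ℤ.* y ℤ.- x ℤ.* ↧ (i / n))
      ≡⟨ distribute g (↥ (i / n)) (↧ (i / n)) x y ⟩
    (↥ (i / n) ℤ.* g) ℤ.* y ℤ.- x ℤ.* (↧ (i / n) ℤ.* g)
      ≡⟨ cong₂ (λ a b → a ℤ.* y ℤ.- x ℤ.* b) ↥*g ↧*g ⟩
    i ℤ.* y ℤ.- x ℤ.* + n
      ≡⟨ bézout ⟩
    1ℤ ∎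
    where
    open ≡-Reasoning
    distribute : ∀ g a b x y → g ℤ.* (a ℤ.* y ℤ.- x ℤ.* b) ≡ (a ℤ.* g) ℤ.* y ℤ.- x ℤ.* (b ℤ.* g)
    distribute = solve-∀
  g≡1 : g ≡ 1ℤ
  g≡1 = cong +_ (ℕP.m*n≡1⇒m≡1 _ _ (trans (sym (ℤP.abs-* g _)) (cong ℤ.∣_∣ g*[…]≡1)))
  cancel-g : ∀ {a b} → a ℤ.* g ≡ b → a ≡ b
  cancel-g {a} a*g≡b = trans (sym (ℤP.*-identityʳ a)) (trans (cong (a ℤ.*_) (sym g≡1)) a*g≡b)
  ↥≡ : ↥ (i / n) ≡ i
  ↥≡ = cancel-g ↥*g
  ↧≡ : ↧ (i / n) ≡ + n
  ↧≡ = cancel-g ↧*g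

private
  det-mediantˡ : ∀ a c b d → (a ℤ.+ c) ℤ.* d ℤ.- c ℤ.* (b ℤ.+ d) ≡ a ℤ.* d ℤ.- c ℤ.* b
  det-mediantˡ = solve-∀
  det-mediantʳ : ∀ a c b d → a ℤ.* (b ℤ.+ d) ℤ.- (a ℤ.+ c) ℤ.* b ≡ a ℤ.* d ℤ.- c ℤ.* b
  det-mediantʳ = solve-∀

module _ {l u : ℚ} (l⋈u : Neighbours l u) where

  open Neighbours l⋈u

  ↥↧ₙ-mediant : ↥ (mediant u l) ≡ ↥ u ℤ.+ ↥ l × ↧ₙ (mediant u l) ≡ ↧ₙ u ℕ.+ ↧ₙ l
  ↥↧ₙ-mediant = bézout⇒/-reduced _ _ (↥ l) (↧ l) (trans (det-mediantˡ (↥ u) (↥ l) (↧ u) (↧ l)) det≡1)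

  private
    m = mediant u l
    ↥m≡ : ↥ m ≡ ↥ u ℤ.+ ↥ l
    ↥m≡ = proj₁ ↥↧ₙ-mediant
    ↧m≡ : ↧ m ≡ ↧ u ℤ.+ ↧ l
    ↧m≡ = cong +_ (proj₂ ↥↧ₙ-mediant)

  neighbours-mediantˡ : Neighbours l (mediant u l)
  neighbours-mediantˡ = neighbours (begin
    ↥ m ℤ.* ↧ l ℤ.- ↥ l ℤ.* ↧ m                         ≡⟨ cong₂ (λ a b → a ℤ.* ↧ l ℤ.- ↥ l ℤ.* b) ↥m≡ ↧m≡ ⟩
    (↥ u ℤ.+ ↥ l) ℤ.* ↧ l ℤ.- ↥ l ℤ.* (↧ u ℤ.+ ↧ l)    ≡⟨ det-mediantˡ (↥ u) (↥ l) (↧ u) (↧ l) ⟩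
    ↥ u ℤ.* ↧ l ℤ.- ↥ l ℤ.* ↧ u                         ≡⟨ det≡1 ⟩
    1ℤ                                                  ∎)
    where open ≡-Reasoning

  neighbours-mediantʳ : Neighbours (mediant u l) u
  neighbours-mediantʳ = neighbours (begin
    ↥ u ℤ.* ↧ m ℤ.- ↥ m ℤ.* ↧ u                         ≡⟨ cong₂ (λ a b → ↥ u ℤ.* b ℤ.- a ℤ.* ↧ u) ↥m≡ ↧m≡ ⟩
    ↥ u ℤ.* (↧ u ℤ.+ ↧ l) ℤ.- (↥ u ℤ.+ ↥ l) ℤ.* ↧ u    ≡⟨ det-mediantʳ (↥ u) (↥ l) (↧ u) (↧ l) ⟩
    ↥ u ℤ.* ↧ l ℤ.- ↥ l ℤ.* ↧ u                         ≡⟨ det≡1 ⟩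
    1ℤ                                                  ∎)
    where open ≡-Reasoning

neighbours⇒< : ∀ {l u} → Neighbours l u → l < u
neighbours⇒< {l} {u} (neighbours det≡1) = ℚ.*<* (ℤP.suc[i]≤j⇒i<j (ℤP.≤-reflexive (begin
  1ℤ ℤ.+ ↥ l ℤ.* ↧ u                               ≡⟨ cong (ℤ._+ ↥ l ℤ.* ↧ u) det≡1 ⟨
  (↥ u ℤ.* ↧ l ℤ.- ↥ l ℤ.* ↧ u) ℤ.+ ↥ l ℤ.* ↧ u    ≡⟨ cancel (↥ u ℤ.* ↧ l) (↥ l ℤ.* ↧ u) ⟩
  ↥ u ℤ.* ↧ l                                      ∎)))
  where
  open ≡-Reasoning
  cancel : ∀ x y → (x ℤ.- y) ℤ.+ y ≡ x
  cancel = solve-∀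

<⇒1≤- : ∀ {x y} → x ℤ.< y → 1ℤ ℤ.≤ y ℤ.- x
<⇒1≤- {x} {y} x<y = ℤP.≤-trans (ℤP.≤-reflexive (sym (cancel x))) (ℤP.+-monoˡ-≤ (ℤ.- x) (ℤP.i<j⇒suc[i]≤j x<y))
  where
  cancel : ∀ x → (1ℤ ℤ.+ x) ℤ.- x ≡ 1ℤ
  cancel = solve-∀

-- With u = a/b, l = c/d, q = p/s:  s = s(ad − cb) = b(pd − cs) + d(as − pb), and both brackets are ≥ 1.
neighbours-↧ₙ-between : ∀ {l u q} → Neighbours l u → l < q → q < u → ↧ₙ u ℕ.+ ↧ₙ l ≤ ↧ₙ q
neighbours-↧ₙ-between {l} {u} {q} (neighbours det≡1) (ℚ.*<* l<q) (ℚ.*<* q<u) = ℤP.drop‿+≤+ (begin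
  ↧ u ℤ.+ ↧ l                                           ≡⟨ cong₂ ℤ._+_ (ℤP.*-identityʳ (↧ u)) (ℤP.*-identityʳ (↧ l)) ⟨
  ↧ u ℤ.* 1ℤ ℤ.+ ↧ l ℤ.* 1ℤ                             ≤⟨ ℤP.+-mono-≤ (ℤP.*-monoˡ-≤-nonNeg (↧ u) (<⇒1≤- l<q))
                                                                        (ℤP.*-monoˡ-≤-nonNeg (↧ l) (<⇒1≤- q<u)) ⟩
  ↧ u ℤ.* (p ℤ.* ↧ l ℤ.- c ℤ.* s) ℤ.+ ↧ l ℤ.* (a ℤ.* s ℤ.- p ℤ.* ↧ u)
                                                        ≡⟨ expand a (↧ u) c (↧ l) p s ⟩
  s ℤ.* (a ℤ.* ↧ l ℤ.- c ℤ.* ↧ u)                       ≡⟨ cong (s ℤ.*_) det≡1 ⟩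
  s ℤ.* 1ℤ                                              ≡⟨ ℤP.*-identityʳ s ⟩
  s                                                     ∎)
  where
  open ℤP.≤-Reasoning
  a = ↥ u; c = ↥ l; p = ↥ q; s = ↧ q
  expand : ∀ a b c d p s → b ℤ.* (p ℤ.* d ℤ.- c ℤ.* s) ℤ.+ d ℤ.* (a ℤ.* s ℤ.- p ℤ.* b) ≡ s ℤ.* (a ℤ.* d ℤ.- c ℤ.* b)
  expand = solve-∀

*↧ₙ<⇒/< : ∀ {ε} F n .{{_ : NonZero n}} → 0ℚ < ε → F ℕ.* ↧ₙ ε ℕ.< n → (+ F) / n < ε
-- Matching ε against its constructor lets Positive ε reduce to positivity of ↥ ε.
*↧ₙ<⇒/< {ε@record{}} F (suc m) 0<ε F*↧ε<n =
  ℚP.toℚᵘ-cancel-< (ℚᵘP.<-respˡ-≃ (ℚᵘP.≃-sym (ℚP.toℚᵘ-fromℚᵘ (mkℚᵘ (+ F) m))) (ℚᵘ.*<* (begin-strict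
    + F ℤ.* ↧ ε              ≡⟨ ℤP.pos-* F (↧ₙ ε) ⟨
    + (F ℕ.* ↧ₙ ε)           <⟨ ℤ.+<+ F*↧ε<n ⟩
    + suc m                  ≡⟨ ℤP.*-identityˡ (+ suc m) ⟨
    1ℤ ℤ.* + suc m           ≤⟨ ℤP.*-monoʳ-≤-nonNeg (+ suc m) 1≤↥ε ⟩
    ↥ ε ℤ.* + suc m          ∎)))
  where
  open ℤP.≤-Reasoning
  1≤↥ε : 1ℤ ℤ.≤ ↥ ε
  1≤↥ε = ℤP.i<j⇒suc[i]≤j (ℤP.positive⁻¹ (↥ ε) {{ℚ.positive 0<ε}})

below-<-notBelow : ∀ α {p q} → below α p ≡ true → below α q ≡ false → p < q
below-<-notBelow α {p} {q} p-below q-notBelow = ℚP.≰⇒> λ q≤p →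
  true≢false (trans (sym (downClosed α q p q≤p p-below)) q-notBelow)
  where
  true≢false : true ≢ false
  true≢false ()

module _ (α : IrrationalIn01) where

  record Bracket : Set where
    field
      lo hi          : ℚ
      lo-below       : below α lo ≡ true
      hi-notBelow    : below α hi ≡ false
      lo-hi-neighbours : Neighbours lo hi

  open Bracket

  mid : Bracket → ℚ
  mid β = mediant (hi β) (lo β)

  narrowBy : ∀ β {b} → below α (mid β) ≡ b → Bracket
  narrowBy β {true}  mid-below = record
    { lo = mid β ; hi = hi β ; lo-below = mid-below ; hi-notBelow = hi-notBelow β
    ; lo-hi-neighbours = neighbours-mediantʳ (lo-hi-neighbours β) }
  narrowBy β {false} mid-below = record
    { lo = lo β ; hi = mid β ; lo-below = lo-below β ; hi-notBelow = mid-below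
    ; lo-hi-neighbours = neighbours-mediantˡ (lo-hi-neighbours β) }

  narrow : Bracket → Bracket
  narrow β = narrowBy β refl

  NarrowsTo : Bracket → Bracket → Set
  NarrowsTo β β′ =
    (below α (mid β) ≡ true  × lo β′ ≡ mid β × hi β′ ≡ hi β) ⊎
    (below α (mid β) ≡ false × lo β′ ≡ lo β  × hi β′ ≡ mid β)

  narrow-narrows : ∀ β → NarrowsTo β (narrow β)
  narrow-narrows β = narrowBy-narrows refl
    where
    narrowBy-narrows : ∀ {b} (mid-below : below α (mid β) ≡ b) → NarrowsTo β (narrowBy β mid-below)
    narrowBy-narrows {true}  mid-below = inj₁ (mid-below , refl , refl)
    narrowBy-narrows {false} mid-below = inj₂ (mid-below , refl , refl)

  ↧ₙ-mid : ∀ β → ↧ₙ (mid β) ≡ ↧ₙ (hi β) ℕ.+ ↧ₙ (lo β)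
  ↧ₙ-mid β = proj₂ (↥↧ₙ-mediant (lo-hi-neighbours β))

  unitBracket : Bracket
  unitBracket = record { lo = 0ℚ ; hi = 1ℚ ; lo-below = below-0 α ; hi-notBelow = notBelow-1 α
                       ; lo-hi-neighbours = neighbours refl }

  bracket : ℕ → Bracket
  bracket zero    = unitBracket
  bracket (suc k) = narrow (bracket k)

  -- bracket k consists of the nearest neighbours of α among F_0, …, F_{k+1}, and approximant k is F_{k+2}.
  approximant : ℕ → ℚ
  approximant k = mid (bracket k)

  lo<mid : ∀ β → lo β < mid β
  lo<mid β = neighbours⇒< (neighbours-mediantˡ (lo-hi-neighbours β))

  mid<hi : ∀ β → mid β < hi β
  mid<hi β = neighbours⇒< (neighbours-mediantʳ (lo-hi-neighbours β))

  ↧ₙ-lo<↧ₙ-mid : ∀ β → ↧ₙ (lo β) ℕ.< ↧ₙ (mid β)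
  ↧ₙ-lo<↧ₙ-mid β = subst (↧ₙ (lo β) ℕ.<_) (sym (↧ₙ-mid β)) (ℕP.m<n+m (↧ₙ (lo β)) (s≤s z≤n))

  ↧ₙ-hi<↧ₙ-mid : ∀ β → ↧ₙ (hi β) ℕ.< ↧ₙ (mid β)
  ↧ₙ-hi<↧ₙ-mid β = subst (↧ₙ (hi β) ℕ.<_) (sym (↧ₙ-mid β)) (ℕP.m<m+n (↧ₙ (hi β)) (s≤s z≤n))

  narrow-↧ₙ-lo : ∀ β → ↧ₙ (lo β) ≤ ↧ₙ (lo (narrow β))
  narrow-↧ₙ-lo β with narrow-narrows β
  ... | inj₁ (_ , lo′≡mid , _) = subst (↧ₙ (lo β) ≤_) (cong ↧ₙ_ (sym lo′≡mid)) (ℕP.<⇒≤ (↧ₙ-lo<↧ₙ-mid β))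
  ... | inj₂ (_ , lo′≡lo  , _) = ℕP.≤-reflexive (cong ↧ₙ_ (sym lo′≡lo))

  narrow-↧ₙ-hi : ∀ β → ↧ₙ (hi β) ≤ ↧ₙ (hi (narrow β))
  narrow-↧ₙ-hi β with narrow-narrows β
  ... | inj₁ (_ , _ , hi′≡hi)  = ℕP.≤-reflexive (cong ↧ₙ_ (sym hi′≡hi))
  ... | inj₂ (_ , _ , hi′≡mid) = subst (↧ₙ (hi β) ≤_) (cong ↧ₙ_ (sym hi′≡mid)) (ℕP.<⇒≤ (↧ₙ-hi<↧ₙ-mid β))

  narrow-↧ₙ-mid : ∀ {M} β → M ≤ ↧ₙ (lo β) → M ≤ ↧ₙ (hi β) → M ℕ.+ ↧ₙ (mid β) ≤ ↧ₙ (mid (narrow β))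
  narrow-↧ₙ-mid {M} β M≤lo M≤hi with narrow-narrows β
  ... | inj₁ (_ , lo′≡mid , hi′≡hi) = begin
    M ℕ.+ ↧ₙ (mid β)                              ≤⟨ ℕP.+-monoˡ-≤ (↧ₙ (mid β)) M≤hi ⟩
    ↧ₙ (hi β) ℕ.+ ↧ₙ (mid β)                      ≡⟨ cong₂ (λ h l → ↧ₙ h ℕ.+ ↧ₙ l) hi′≡hi lo′≡mid ⟨
    ↧ₙ (hi (narrow β)) ℕ.+ ↧ₙ (lo (narrow β))     ≡⟨ ↧ₙ-mid (narrow β) ⟨
    ↧ₙ (mid (narrow β))                           ∎
    where open ℕP.≤-Reasoning
  ... | inj₂ (_ , lo′≡lo , hi′≡mid) = begin
    M ℕ.+ ↧ₙ (mid β)                              ≤⟨ ℕP.+-monoˡ-≤ (↧ₙ (mid β)) M≤lo ⟩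
    ↧ₙ (lo β) ℕ.+ ↧ₙ (mid β)                      ≡⟨ ℕP.+-comm (↧ₙ (lo β)) (↧ₙ (mid β)) ⟩
    ↧ₙ (mid β) ℕ.+ ↧ₙ (lo β)                      ≡⟨ cong₂ (λ h l → ↧ₙ h ℕ.+ ↧ₙ l) hi′≡mid lo′≡lo ⟨
    ↧ₙ (hi (narrow β)) ℕ.+ ↧ₙ (lo (narrow β))     ≡⟨ ↧ₙ-mid (narrow β) ⟨
    ↧ₙ (mid (narrow β))                           ∎
    where open ℕP.≤-Reasoning

  ↧ₙ-lo-mono : ∀ {k j} → k ≤ j → ↧ₙ (lo (bracket k)) ≤ ↧ₙ (lo (bracket j))
  ↧ₙ-lo-mono = stepwise-mono (λ k → ↧ₙ (lo (bracket k))) (λ k → narrow-↧ₙ-lo (bracket k))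

  ↧ₙ-hi-mono : ∀ {k j} → k ≤ j → ↧ₙ (hi (bracket k)) ≤ ↧ₙ (hi (bracket j))
  ↧ₙ-hi-mono = stepwise-mono (λ k → ↧ₙ (hi (bracket k))) (λ k → narrow-↧ₙ-hi (bracket k))

  HiMovesAfter LoMovesAfter : ℕ → Set
  HiMovesAfter k = ∃ λ j → k ≤ j × hi (bracket (suc j)) ≡ approximant j
  LoMovesAfter k = ∃ λ j → k ≤ j × lo (bracket (suc j)) ≡ approximant j

  hi-moves-or-↧ₙ-lo-grows : ∀ k t → HiMovesAfter k ⊎
    (hi (bracket (t ℕ.+ k)) ≡ hi (bracket k) × t ≤ ↧ₙ (lo (bracket (t ℕ.+ k))))
  hi-moves-or-↧ₙ-lo-grows k zero = inj₂ (refl , z≤n)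
  hi-moves-or-↧ₙ-lo-grows k (suc t) with hi-moves-or-↧ₙ-lo-grows k t
  ... | inj₁ moved = inj₁ moved
  ... | inj₂ (hi≡ , t≤lo) with narrow-narrows (bracket (t ℕ.+ k))
  ...   | inj₂ (_ , _ , hi′≡mid)        = inj₁ (t ℕ.+ k , ℕP.m≤n+m k t , hi′≡mid)
  ...   | inj₁ (_ , lo′≡mid , hi′≡hi) = inj₂ (trans hi′≡hi hi≡ ,
    subst (t ℕ.<_) (cong ↧ₙ_ (sym lo′≡mid)) (ℕP.≤-<-trans t≤lo (↧ₙ-lo<↧ₙ-mid (bracket (t ℕ.+ k)))))

  lo-moves-or-↧ₙ-hi-grows : ∀ k t → LoMovesAfter k ⊎
    (lo (bracket (t ℕ.+ k)) ≡ lo (bracket k) × t ≤ ↧ₙ (hi (bracket (t ℕ.+ k))))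
  lo-moves-or-↧ₙ-hi-grows k zero = inj₂ (refl , z≤n)
  lo-moves-or-↧ₙ-hi-grows k (suc t) with lo-moves-or-↧ₙ-hi-grows k t
  ... | inj₁ moved = inj₁ moved
  ... | inj₂ (lo≡ , t≤hi) with narrow-narrows (bracket (t ℕ.+ k))
  ...   | inj₁ (_ , lo′≡mid , _)        = inj₁ (t ℕ.+ k , ℕP.m≤n+m k t , lo′≡mid)
  ...   | inj₂ (_ , lo′≡lo , hi′≡mid) = inj₂ (trans lo′≡lo lo≡ ,
    subst (t ℕ.<_) (cong ↧ₙ_ (sym hi′≡mid)) (ℕP.≤-<-trans t≤hi (↧ₙ-hi<↧ₙ-mid (bracket (t ℕ.+ k)))))

  -- Irrationality gives r with α < r < hi; were hi fixed until ↧ₙ lo > ↧ₙ r, r would lie strictly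
  -- between the neighbours lo and hi with too small a denominator.
  hi-moves : ∀ k → HiMovesAfter k
  hi-moves k with upperOpen α (hi (bracket k)) (hi-notBelow (bracket k))
  ... | r , r<hi , r-notBelow with hi-moves-or-↧ₙ-lo-grows k (suc (↧ₙ r))
  ...   | inj₁ moved = moved
  ...   | inj₂ (hi≡ , ↧ₙr<↧ₙlo) = ⊥-elim (ℕP.≤⇒≯ (ℕP.m+n≤o⇒n≤o (↧ₙ (hi β)) ↧ₙ-between) ↧ₙr<↧ₙlo)
    where
    β = bracket (suc (↧ₙ r) ℕ.+ k)
    ↧ₙ-between : ↧ₙ (hi β) ℕ.+ ↧ₙ (lo β) ≤ ↧ₙ r
    ↧ₙ-between = neighbours-↧ₙ-between (lo-hi-neighbours β)
                   (below-<-notBelow α (lo-below β) r-notBelow) (subst (r <_) (sym hi≡) r<hi)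

  lo-moves : ∀ k → LoMovesAfter k
  lo-moves k with lowerOpen α (lo (bracket k)) (lo-below (bracket k))
  ... | r , lo<r , r-below with lo-moves-or-↧ₙ-hi-grows k (suc (↧ₙ r))
  ...   | inj₁ moved = moved
  ...   | inj₂ (lo≡ , ↧ₙr<↧ₙhi) = ⊥-elim (ℕP.≤⇒≯ (ℕP.m+n≤o⇒m≤o (↧ₙ (hi β)) ↧ₙ-between) ↧ₙr<↧ₙhi)
    where
    β = bracket (suc (↧ₙ r) ℕ.+ k)
    ↧ₙ-between : ↧ₙ (hi β) ℕ.+ ↧ₙ (lo β) ≤ ↧ₙ r
    ↧ₙ-between = neighbours-↧ₙ-between (lo-hi-neighbours β)
                   (subst (_< r) (sym lo≡) lo<r) (below-<-notBelow α r-below (hi-notBelow β))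

  ↧ₙ-hi-unbounded : ∀ M → ∃ λ K → M ≤ ↧ₙ (hi (bracket K))
  ↧ₙ-hi-unbounded zero = 0 , z≤n
  ↧ₙ-hi-unbounded (suc M) with ↧ₙ-hi-unbounded M
  ... | K , M≤hi with hi-moves K
  ... | j , K≤j , hi′≡mid = suc j , subst (M ℕ.<_) (cong ↧ₙ_ (sym hi′≡mid))
    (ℕP.≤-<-trans (ℕP.≤-trans M≤hi (↧ₙ-hi-mono K≤j)) (↧ₙ-hi<↧ₙ-mid (bracket j)))

  ↧ₙ-lo-unbounded : ∀ M → ∃ λ K → M ≤ ↧ₙ (lo (bracket K))
  ↧ₙ-lo-unbounded zero = 0 , z≤n
  ↧ₙ-lo-unbounded (suc M) with ↧ₙ-lo-unbounded M
  ... | K , M≤lo with lo-moves K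
  ... | j , K≤j , lo′≡mid = suc j , subst (M ℕ.<_) (cong ↧ₙ_ (sym lo′≡mid))
    (ℕP.≤-<-trans (ℕP.≤-trans M≤lo (↧ₙ-lo-mono K≤j)) (↧ₙ-lo<↧ₙ-mid (bracket j)))

  ↧ₙ-approximant-growth : ∀ M → ∃ λ K → ∀ i → K ≤ i → M ℕ.+ ↧ₙ (approximant i) ≤ ↧ₙ (approximant (suc i))
  ↧ₙ-approximant-growth M with ↧ₙ-lo-unbounded M | ↧ₙ-hi-unbounded M
  ... | K₁ , M≤lo | K₂ , M≤hi = K₁ ℕ.+ K₂ , λ i K≤i → narrow-↧ₙ-mid (bracket i)
    (ℕP.≤-trans M≤lo (↧ₙ-lo-mono (ℕP.≤-trans (ℕP.m≤m+n K₁ K₂) K≤i)))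
    (ℕP.≤-trans M≤hi (↧ₙ-hi-mono (ℕP.≤-trans (ℕP.m≤n+m K₂ K₁) K≤i)))

  Endpoints : List ℚ → Bracket → Set
  Endpoints L β = minAbove α L ≡ hi β × maxBelow α L ≡ lo β

  step-endpoints : ∀ L {β} → Endpoints L β → Endpoints (step α L) (narrow β)
  step-endpoints L {β} (refl , refl) with narrow-narrows β
  ... | inj₁ (mid-below , lo′≡mid , hi′≡hi) =
    trans (cong (λ b → if b then hi β else mid β ⊓ hi β) mid-below) (sym hi′≡hi) ,
    trans (cong (λ b → if b then mid β ⊔ lo β else lo β) mid-below)
          (trans (ℚP.p≥q⇒p⊔q≡p (ℚP.<⇒≤ (lo<mid β))) (sym lo′≡mid))
  ... | inj₂ (mid-above , lo′≡lo , hi′≡mid) =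
    trans (cong (λ b → if b then hi β else mid β ⊓ hi β) mid-above)
          (trans (ℚP.p≤q⇒p⊓q≡p (ℚP.<⇒≤ (mid<hi β))) (sym hi′≡mid)) ,
    trans (cong (λ b → if b then mid β ⊔ lo β else lo β) mid-above) (sym lo′≡lo)

  approxs-endpoints : ∀ k → Endpoints (approxs α (2 ℕ.+ k)) (bracket k)
  approxs-endpoints zero rewrite notBelow-1 α | below-0 α = ℚP.⊓-idem 1ℚ , ℚP.⊔-idem 0ℚ
  approxs-endpoints (suc k) = step-endpoints (approxs α (2 ℕ.+ k)) (approxs-endpoints k)

  approxs-unfold : ∀ k → approxs α (2 ℕ.+ k) ≡ applyDownFrom approximant k ++ 1ℚ ∷ 0ℚ ∷ []
  approxs-unfold zero    = refl
  approxs-unfold (suc k) =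
    let hi≡ , lo≡ = approxs-endpoints k
    in  cong₂ _∷_ (cong₂ mediant hi≡ lo≡) (approxs-unfold k)

fareyCount-≤ : ∀ α m → fareyCount α (suc m) ≤
               count≤ (suc m) (applyDownFrom (λ k → ↧ₙ (approximant α k)) m) ℕ.+ 2
fareyCount-≤ α m = begin
  fareyCount α (suc m)                                          ≤⟨ ListP.length-deduplicate ℚP._≟_ (filter inFarey? (approxs α (2 ℕ.+ m))) ⟩
  length (filter inFarey? (approxs α (2 ℕ.+ m)))                ≡⟨ cong (length ∘ filter inFarey?) (approxs-unfold α m) ⟩
  length (filter inFarey? (As ++ 1ℚ ∷ 0ℚ ∷ []))                 ≡⟨ cong length (ListP.filter-++ inFarey? As (1ℚ ∷ 0ℚ ∷ [])) ⟩
  length (filter inFarey? As ++ filter inFarey? (1ℚ ∷ 0ℚ ∷ [])) ≡⟨ ListP.length-++ (filter inFarey? As) ⟩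
  length (filter inFarey? As) ℕ.+ length (filter inFarey? (1ℚ ∷ 0ℚ ∷ []))
      ≤⟨ ℕP.+-mono-≤ (length-filter-map inFarey? (ℕ._≤? suc m) ↧ₙ_ (λ q∈ → proj₂ (proj₂ q∈)) As)
                     (ListP.length-filter inFarey? (1ℚ ∷ 0ℚ ∷ [])) ⟩
  count≤ (suc m) (map ↧ₙ_ As) ℕ.+ 2                              ≡⟨ cong (λ ds → count≤ (suc m) ds ℕ.+ 2)
                                                                          (ListP.map-applyDownFrom (approximant α) ↧ₙ_ m) ⟩
  count≤ (suc m) (applyDownFrom (λ k → ↧ₙ (approximant α k)) m) ℕ.+ 2 ∎
  where
  open ℕP.≤-Reasoning
  As = applyDownFrom (approximant α) m
  inFarey? = λ q → (0ℚ ℚP.≤? q) ×-dec ((q ℚP.≤? 1ℚ) ×-dec (↧ₙ q ℕ.≤? suc m))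

fareyCount-sublinear : ∀ α M → ∃ λ N → ∀ n → N ≤ n → fareyCount α n ℕ.* M ℕ.< n
fareyCount-sublinear α M with ↧ₙ-approximant-growth α (2 ℕ.* M)
... | K , grow = suc ((K ℕ.+ 3) ℕ.* (2 ℕ.* M)) , bound
  where
  bound : ∀ n → suc ((K ℕ.+ 3) ℕ.* (2 ℕ.* M)) ≤ n → fareyCount α n ℕ.* M ℕ.< n
  bound zero    ()
  bound (suc m) N≤n = ℕP.*-cancelˡ-< 2 _ _ (begin-strict
    2 ℕ.* (F ℕ.* M)                               ≡⟨ shuffle F M ⟩
    F ℕ.* M₂                                      ≤⟨ ℕP.*-monoˡ-≤ M₂ (fareyCount-≤ α m) ⟩
    (C ℕ.+ 2) ℕ.* M₂                              ≡⟨ ℕP.*-distribʳ-+ M₂ C 2 ⟩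
    C ℕ.* M₂ ℕ.+ 2 ℕ.* M₂                         ≤⟨ ℕP.+-monoˡ-≤ (2 ℕ.* M₂) (count≤-applyDownFrom-linear {K = K} (eventual-growth⇒linear grow) n m) ⟩
    K ℕ.* M₂ ℕ.+ n ℕ.+ M₂ ℕ.+ 2 ℕ.* M₂            ≡⟨ collect K M₂ n ⟩
    (K ℕ.+ 3) ℕ.* M₂ ℕ.+ n                        <⟨ ℕP.+-monoˡ-< n N≤n ⟩
    n ℕ.+ n                                       ≡⟨ cong (n ℕ.+_) (ℕP.+-identityʳ n) ⟨
    2 ℕ.* n                                       ∎)
    where
    open ℕP.≤-Reasoning
    n = suc m
    M₂ = 2 ℕ.* M
    F = fareyCount α n
    C = count≤ n (applyDownFrom (λ k → ↧ₙ (approximant α k)) m)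
    shuffle : ∀ F M → 2 ℕ.* (F ℕ.* M) ≡ F ℕ.* (2 ℕ.* M)
    shuffle = ℕ-solve-∀
    collect : ∀ K M n → K ℕ.* M ℕ.+ n ℕ.+ M ℕ.+ 2 ℕ.* M ≡ (K ℕ.+ 3) ℕ.* M ℕ.+ n
    collect = ℕ-solve-∀

lemma5p2 : (α : IrrationalIn01) → (ε : ℚ) → 0ℚ < ε →
    ∃ λ N → ∀ n → .{{_ : NonZero n}} → N ≤ n → (+ fareyCount α n) / n < ε
lemma5p2 α ε 0<ε =
  let N , sublinear = fareyCount-sublinear α (↧ₙ ε)
  in  N , λ n N≤n → *↧ₙ<⇒/< (fareyCount α n) n 0<ε (sublinear n N≤n)
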